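{- Let $m_1,n_1,m_2,n_2$ be non-negative integers with $m_1+n_1=m_2+n_2$ and $|m_1-n_1|\le|m_2-n_2|$. Then $\beta(\mathbf c^{m_1}\mathbf d\mathbf c^{n_1})\ge\beta(\mathbf c^{m_2}\mathbf d\mathbf c^{n_2})$, with equality if and only if $|m_1-n_1|=|m_2-n_2|$.
   Context: For a graded poset $P$ of rank $r+1$ with $\hat0,\hat1$ and $S\subseteq[r]$, $f_S$ counts chains $\hat0<x_1<\dots<x_j<\hat1$ with rank set $S$, $h_S=\sum_{T\subseteq S}(-1)^{|S-T|}f_T$, and the ab-index is $\sum_S h_S u_1\cdots u_r$ with $u_i=\mathbf b$ if $i\in S$, $\mathbf a$ otherwise. For Eulerian $P$ it is uniquely a polynomial $\Psi(P)$ in the non-commuting variables $\mathbf c=\mathbf a+\mathbf b$ (degree 1), $\mathbf d=\mathbf a\mathbf b+\mathbf b\mathbf a$ (degree 2). $B_{r+1}$ is the Boolean lattice of subsets of $[r+1]$. For a word $v$ of degree $r$, $\beta(v)$ is the coefficient of $v$ in $\Psi(B_{r+1})$. (In list notation $\mathbf c^{m}\mathbf d\mathbf c^{n}$ is $(m,n)$.) -}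

module Defs where

open import Data.Bool using (Bool; true; false; if_then_else_)
open import Data.Nat using (ℕ; zero; suc; _+_; _≟_)
open import Data.Integer as ℤ using (ℤ)
open import Data.Fin using (Fin; toℕ)
open import Data.Fin.Subset using (Subset; inside; outside; ∣_∣; _⊆_; _⊂_; ⊥; ⊤; _∈_)
open import Data.Fin.Subset.Properties using (_⊆?_; _⊂?_; _∈?_)
open import Data.List using (List; []; _∷_; map; _++_; filterᵇ; foldr; allFin)
open import Data.Vec using (Vec; []; _∷_; toList)
open import Relation.Nullary using (yes; no)
open import Relation.Nullary.Decidable using (⌊_⌋)

allSubsets : (n : ℕ) → List (Subset n)
allSubsets zero    = [] ∷ []
allSubsets (suc n) = map (outside ∷_) (allSubsets n) ++ map (inside ∷_) (allSubsets n)

-- The Boolean lattice B_N: subsets of [N] ordered by inclusion,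
-- 0̂ = ∅, 1̂ = [N], rank ρ(x) = |x|, x < y iff x ⊂ y.

countChains : (N : ℕ) → Subset N → List ℕ → ℕ
countChains N prev []       with prev ⊂? ⊤
... | yes _ = 1
... | no  _ = 0
countChains N prev (s ∷ ss) =
  foldr _+_ 0 (map (λ y → countChains N y ss)
           (filterᵇ (λ y → ⌊ ∣ y ∣ ≟ s ⌋ Data.Bool.∧ ⌊ prev ⊂? y ⌋) (allSubsets N)))
  where import Data.Bool

-- A subset S ⊆ [r] is represented by a vector of length r whose i-th
-- entry (i = 0..r-1) says whether the rank i+1 belongs to S.
-- The increasing list of ranks in S:
rankList : {r : ℕ} → Subset r → List ℕ
rankList {r} S = map (λ i → suc (toℕ i)) (filterᵇ (λ i → ⌊ i ∈? S ⌋) (allFin r))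

fB : (r : ℕ) → Subset r → ℕ
fB r S = countChains (suc r) ⊥ (rankList S)

signPow : ℕ → ℤ
signPow zero          = ℤ.+ 1
signPow (suc zero)    = ℤ.- (ℤ.+ 1)
signPow (suc (suc k)) = signPow k

hB : (r : ℕ) → Subset r → ℤ
hB r S = Data.List.foldr ℤ._+_ (ℤ.+ 0)
  (map (λ T → signPow (∣ S ∣ Data.Nat.∸ ∣ T ∣) ℤ.* ℤ.+ (fB r T))
       (filterᵇ (λ T → ⌊ T ⊆? S ⌋) (allSubsets r)))
  where import Data.List; import Data.Nat

-- The ab-index of B_{r+1}: coefficient of the ab-word u_1 ⋯ u_r
-- (u_i = b iff i ∈ S, encoded as the Subset S itself) is h_S.
abIndexB : (r : ℕ) → Subset r → ℤ
abIndexB = hB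

-- cd-words and their ab-expansion (c = a + b, d = ab + ba).
-- ab-words are Bool lists: false = a, true = b.

data CD : Set where
  c d : CD

cdWords : ℕ → List (List CD)
cdWords zero          = [] ∷ []
cdWords (suc zero)    = (c ∷ []) ∷ []
cdWords (suc (suc n)) = map (c ∷_) (cdWords (suc n)) ++ map (d ∷_) (cdWords n)

abCoeff : List CD → List Bool → ℕ
abCoeff []      []            = 1
abCoeff (c ∷ u) (_ ∷ w)       = abCoeff u w
abCoeff (d ∷ u) (false ∷ true ∷ w) = abCoeff u w
abCoeff (d ∷ u) (true ∷ false ∷ w) = abCoeff u w
abCoeff _       _             = 0

IsCDIndexOfBoolean : (r : ℕ) → (List CD → ℤ) → Set
IsCDIndexOfBoolean r ψ =
  (S : Subset r) →
  abIndexB r S ≡ Data.List.foldr ℤ._+_ (ℤ.+ 0)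
                   (map (λ u → ψ u ℤ.* ℤ.+ (abCoeff u (toList S))) (cdWords r))
  where open import Relation.Binary.PropositionalEquality using (_≡_)
        import Data.List

cmdcn : ℕ → ℕ → List CD
cmdcn m n = Data.List.replicate m c ++ (d ∷ Data.List.replicate n c)
  where import Data.List

-- Evaluating the defining identity of the cd-index at the rank sets ∅ and {k + 1} of
-- B_{r+1} gives β(cʳ) = h_∅ = 1 and, since only cʳ, cᵏ⁻¹dcʲ and cᵏdcʲ⁻¹ (with k + j + 1 = r)
-- contain a^k b a^j in their ab-expansion,
--   1 + β(cᵏ⁻¹dcʲ) + β(cᵏdcʲ⁻¹) = h_{k+1} = f_{k+1} − f_∅ = C(r + 1, k + 1) − 1.
-- By Pascal's rule this recursion in k is solved by β(cᵐdcⁿ) = C(m + n + 2, m + 1) − 1.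
-- For fixed N = m + n, C(N, m) = C(N, min(m, n)) and N = 2 min(m, n) + |m − n|, so C(N, m) is
-- a function of |m − n|; it strictly decreases in |m − n| because C(N, k) < C(N, k + 1) for
-- 2(k + 1) ≤ N, by C(N, k + 1)(k + 1) = C(N, k)(N − k).
module Submission where

open import Defs
open import Algebra.Core using (Op₂)
open import Algebra.Structures using (IsMonoid)
open import Data.Bool using (Bool; true; false; if_then_else_; _∧_)
open import Data.Fin using (toℕ) renaming (suc to fsuc)
open import Data.Fin.Subset using (Subset; inside; outside; ⊥; ⊤; ∣_∣)
open import Data.Fin.Subset.Properties using (_⊆?_; _⊂?_; _∈?_; ⊥⊆; ⊆⊤; ∣⊥∣≡0)
open import Data.Integer as ℤ using (ℤ; 0ℤ; 1ℤ; -1ℤ; +<+)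
import Data.Integer.Properties as ℤP
open import Data.Integer.Tactic.RingSolver renaming (solve-∀ to ℤ-solve-∀)
open import Data.List using (List; []; _∷_; map; _++_; filterᵇ; foldr; allFin; replicate; tabulate)
open import Data.List.Properties using (map-tabulate; map-∘; map-cong)
open import Data.Nat as ℕ using (ℕ; zero; suc; _+_; _*_; _∸_; _≤_; _<_; _⊓_; ∣_-_∣; _!; s≤s; z<s)
open import Data.Nat.Combinatorics
  using (_C_; nCk≡n!/k![n-k]!; k![n∸k]!∣n!; [n-k]*[n-k-1]!≡[n-k]!; nCk≡nC[n∸k]; nCk+nC[k+1]≡[n+1]C[k+1])
open import Data.Nat.DivMod using (m/n*n≡m)
import Data.Nat.Properties as ℕP
open import Data.Nat.Tactic.RingSolver using (solve-∀)
open import Data.Product using (_×_; _,_)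
open import Data.Sum using (inj₁; inj₂)
open import Data.Vec using ([]; _∷_; toList)
open import Function using (_∘_; id; _⇔_; mk⇔)
open import Relation.Nullary using (yes; no; contradiction)
open import Relation.Nullary.Decidable using (does; ⌊_⌋; isYes≗does; ⌊⌋-map′; dec-true)
open import Relation.Binary.PropositionalEquality

-- Binomial coefficients

nCk*[k!*[n∸k]!]≡n! : ∀ {n k} → k ≤ n → (n C k) * (k ! * (n ∸ k) !) ≡ n !
nCk*[k!*[n∸k]!]≡n! {n} {k} k≤n =
  trans (cong (_* (k ! * (n ∸ k) !)) (nCk≡n!/k![n-k]! k≤n)) (m/n*n≡m (k![n∸k]!∣n! k≤n))
  where instance _ = k ℕP.!* (n ∸ k) !≢0

0<nCk : ∀ {n k} → k ≤ n → 0 < n C k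
0<nCk {n} {k} k≤n = ℕP.n≢0⇒n>0 λ nCk≡0 →
  ℕ.≢-nonZero⁻¹ (n !) {{n ℕP.!≢0}} (trans (sym (nCk*[k!*[n∸k]!]≡n! k≤n)) (cong (_* (k ! * (n ∸ k) !)) nCk≡0))

nC[k+1]*[k+1]≡nCk*[n∸k] : ∀ {n k} → k < n → (n C suc k) * suc k ≡ (n C k) * (n ∸ k)
nC[k+1]*[k+1]≡nCk*[n∸k] {n} {k} k<n =
  ℕP.*-cancelʳ-≡ _ _ (k ! * (n ∸ suc k) !) {{k ℕP.!* (n ∸ suc k) !≢0}} (begin
    (n C suc k) * suc k * (k ! * (n ∸ suc k) !)     ≡⟨ regroup (n C suc k) (suc k) (k !) ((n ∸ suc k) !) ⟩
    (n C suc k) * (suc k ! * (n ∸ suc k) !)         ≡⟨ nCk*[k!*[n∸k]!]≡n! k<n ⟩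
    n !                                             ≡⟨ nCk*[k!*[n∸k]!]≡n! (ℕP.<⇒≤ k<n) ⟨
    (n C k) * (k ! * (n ∸ k) !)                     ≡⟨ cong (λ x → (n C k) * (k ! * x)) ([n-k]*[n-k-1]!≡[n-k]! k<n) ⟨
    (n C k) * (k ! * ((n ∸ k) * (n ∸ suc k) !))     ≡⟨ regroup′ (n C k) (n ∸ k) (k !) ((n ∸ suc k) !) ⟩
    (n C k) * (n ∸ k) * (k ! * (n ∸ suc k) !)       ∎)
  where
  open ≡-Reasoning
  regroup : ∀ x s f g → x * s * (f * g) ≡ x * (s * f * g)
  regroup = solve-∀
  regroup′ : ∀ x s f g → x * (f * (s * g)) ≡ x * s * (f * g)
  regroup′ = solve-∀

nCk<nC[k+1] : ∀ {n k} → 2 * suc k ≤ n → n C k < n C suc k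
nCk<nC[k+1] {n} {k} 2[k+1]≤n = ℕP.*-cancelʳ-< (suc k) (n C k) (n C suc k) (begin-strict
  (n C k) * suc k          <⟨ ℕP.*-monoʳ-< (n C k) {{ℕ.>-nonZero (0<nCk (ℕP.<⇒≤ k<n))}} k+1<n∸k ⟩
  (n C k) * (n ∸ k)        ≡⟨ nC[k+1]*[k+1]≡nCk*[n∸k] k<n ⟨
  (n C suc k) * suc k      ∎)
  where
  open ℕP.≤-Reasoning
  k+2+k≤n : suc (suc k) + k ≤ n
  k+2+k≤n = ℕP.≤-trans (ℕP.≤-reflexive (shape k)) 2[k+1]≤n
    where shape : ∀ k → suc (suc k) + k ≡ 2 * suc k
          shape = solve-∀
  k<n : k < n
  k<n = ℕP.<⇒≤ (ℕP.m+n≤o⇒m≤o (suc (suc k)) k+2+k≤n)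
  k+1<n∸k : suc k < n ∸ k
  k+1<n∸k = ℕP.m+n≤o⇒m≤o∸n (suc (suc k)) k+2+k≤n

nCk<nCl : ∀ {n k l} → k < l → 2 * l ≤ n → n C k < n C l
nCk<nCl {l = suc l} (s≤s k≤l) 2[l+1]≤n with ℕP.m≤n⇒m<n∨m≡n k≤l
... | inj₁ k<l  = ℕP.<-trans (nCk<nCl k<l 2l≤n) (nCk<nC[k+1] 2[l+1]≤n)
  where 2l≤n = ℕP.≤-trans (ℕP.*-monoʳ-≤ 2 (ℕP.n≤1+n l)) 2[l+1]≤n
... | inj₂ refl = nCk<nC[k+1] 2[l+1]≤n

[m+n]Cm≡[m+n]C[m⊓n] : ∀ m n → (m + n) C m ≡ (m + n) C (m ⊓ n)
[m+n]Cm≡[m+n]C[m⊓n] m n with ℕP.≤-total m n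
... | inj₁ m≤n = cong ((m + n) C_) (sym (ℕP.m≤n⇒m⊓n≡m m≤n))
... | inj₂ n≤m = begin
  (m + n) C m             ≡⟨ nCk≡nC[n∸k] (ℕP.m≤m+n m n) ⟩
  (m + n) C (m + n ∸ m)   ≡⟨ cong ((m + n) C_) (ℕP.m+n∸m≡n m n) ⟩
  (m + n) C n             ≡⟨ cong ((m + n) C_) (ℕP.m≥n⇒m⊓n≡n n≤m) ⟨
  (m + n) C (m ⊓ n)       ∎
  where open ≡-Reasoning

m≤n⇒m+n≡2[m⊓n]+∣m-n∣ : ∀ {m n} → m ≤ n → m + n ≡ 2 * (m ⊓ n) + ∣ m - n ∣
m≤n⇒m+n≡2[m⊓n]+∣m-n∣ {m} {n} m≤n = begin
  m + n                   ≡⟨ cong (m +_) (ℕP.m+[n∸m]≡n m≤n) ⟨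
  m + (m + (n ∸ m))       ≡⟨ double m (n ∸ m) ⟩
  2 * m + (n ∸ m)         ≡⟨ cong₂ (λ k d → 2 * k + d) (ℕP.m≤n⇒m⊓n≡m m≤n) (ℕP.m≤n⇒∣m-n∣≡n∸m m≤n) ⟨
  2 * (m ⊓ n) + ∣ m - n ∣ ∎
  where
  open ≡-Reasoning
  double : ∀ m d → m + (m + d) ≡ 2 * m + d
  double = solve-∀

m+n≡2[m⊓n]+∣m-n∣ : ∀ m n → m + n ≡ 2 * (m ⊓ n) + ∣ m - n ∣
m+n≡2[m⊓n]+∣m-n∣ m n with ℕP.≤-total m n
... | inj₁ m≤n = m≤n⇒m+n≡2[m⊓n]+∣m-n∣ m≤n
... | inj₂ n≤m = begin
  m + n                   ≡⟨ ℕP.+-comm m n ⟩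
  n + m                   ≡⟨ m≤n⇒m+n≡2[m⊓n]+∣m-n∣ n≤m ⟩
  2 * (n ⊓ m) + ∣ n - m ∣ ≡⟨ cong₂ (λ k d → 2 * k + d) (ℕP.⊓-comm n m) (ℕP.∣-∣-comm n m) ⟩
  2 * (m ⊓ n) + ∣ m - n ∣ ∎
  where open ≡-Reasoning

more-balanced⇒larger-binomial : ∀ {m₁ n₁ m₂ n₂} → m₁ + n₁ ≡ m₂ + n₂ →
  ∣ m₁ - n₁ ∣ < ∣ m₂ - n₂ ∣ → (m₂ + n₂) C m₂ < (m₁ + n₁) C m₁
more-balanced⇒larger-binomial {m₁} {n₁} {m₂} {n₂} sum≡ gap< = begin-strict
  (m₂ + n₂) C m₂         ≡⟨ [m+n]Cm≡[m+n]C[m⊓n] m₂ n₂ ⟩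
  (m₂ + n₂) C (m₂ ⊓ n₂)  ≡⟨ cong (_C (m₂ ⊓ n₂)) sum≡ ⟨
  (m₁ + n₁) C (m₂ ⊓ n₂)  <⟨ nCk<nCl min₂<min₁ 2min₁≤sum ⟩
  (m₁ + n₁) C (m₁ ⊓ n₁)  ≡⟨ [m+n]Cm≡[m+n]C[m⊓n] m₁ n₁ ⟨
  (m₁ + n₁) C m₁         ∎
  where
  open ℕP.≤-Reasoning
  2min₁≤sum : 2 * (m₁ ⊓ n₁) ≤ m₁ + n₁
  2min₁≤sum = ℕP.≤-trans (ℕP.m≤m+n _ _) (ℕP.≤-reflexive (sym (m+n≡2[m⊓n]+∣m-n∣ m₁ n₁)))
  min₂<min₁ : m₂ ⊓ n₂ < m₁ ⊓ n₁
  min₂<min₁ = ℕP.*-cancelˡ-< 2 _ _ (ℕP.+-cancelʳ-< ∣ m₂ - n₂ ∣ _ _ (begin-strict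
    2 * (m₂ ⊓ n₂) + ∣ m₂ - n₂ ∣  ≡⟨ m+n≡2[m⊓n]+∣m-n∣ m₂ n₂ ⟨
    m₂ + n₂                      ≡⟨ sum≡ ⟨
    m₁ + n₁                      ≡⟨ m+n≡2[m⊓n]+∣m-n∣ m₁ n₁ ⟩
    2 * (m₁ ⊓ n₁) + ∣ m₁ - n₁ ∣  <⟨ ℕP.+-monoʳ-< (2 * (m₁ ⊓ n₁)) gap< ⟩
    2 * (m₁ ⊓ n₁) + ∣ m₂ - n₂ ∣  ∎))

equally-balanced⇒equal-binomial : ∀ {m₁ n₁ m₂ n₂} → m₁ + n₁ ≡ m₂ + n₂ →
  ∣ m₁ - n₁ ∣ ≡ ∣ m₂ - n₂ ∣ → (m₁ + n₁) C m₁ ≡ (m₂ + n₂) C m₂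
equally-balanced⇒equal-binomial {m₁} {n₁} {m₂} {n₂} sum≡ gap≡ = begin
  (m₁ + n₁) C m₁         ≡⟨ [m+n]Cm≡[m+n]C[m⊓n] m₁ n₁ ⟩
  (m₁ + n₁) C (m₁ ⊓ n₁)  ≡⟨ cong₂ _C_ sum≡ min₁≡min₂ ⟩
  (m₂ + n₂) C (m₂ ⊓ n₂)  ≡⟨ [m+n]Cm≡[m+n]C[m⊓n] m₂ n₂ ⟨
  (m₂ + n₂) C m₂         ∎
  where
  open ≡-Reasoning
  min₁≡min₂ : m₁ ⊓ n₁ ≡ m₂ ⊓ n₂
  min₁≡min₂ = ℕP.*-cancelˡ-≡ _ _ 2 (ℕP.+-cancelʳ-≡ ∣ m₂ - n₂ ∣ _ _ (begin
    2 * (m₁ ⊓ n₁) + ∣ m₂ - n₂ ∣  ≡⟨ cong (2 * (m₁ ⊓ n₁) +_) gap≡ ⟨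
    2 * (m₁ ⊓ n₁) + ∣ m₁ - n₁ ∣  ≡⟨ m+n≡2[m⊓n]+∣m-n∣ m₁ n₁ ⟨
    m₁ + n₁                      ≡⟨ sum≡ ⟩
    m₂ + n₂                      ≡⟨ m+n≡2[m⊓n]+∣m-n∣ m₂ n₂ ⟩
    2 * (m₂ ⊓ n₂) + ∣ m₂ - n₂ ∣  ∎))

-- The rank set {k + 1} inside [k + j + 1]; ranks are shifted by one against the vector index.
singleton : (k j : ℕ) → Subset (suc (k + j))
singleton zero    j = inside ∷ ⊥
singleton (suc k) j = outside ∷ singleton k j

module MonoidSum {A : Set} {_∙_ : Op₂ A} {ε : A} (isMonoid : IsMonoid _≡_ _∙_ ε) where
  open IsMonoid isMonoid using (assoc; identityˡ; identityʳ)

  sum : {B : Set} → List B → (B → A) → A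
  sum xs f = foldr _∙_ ε (map f xs)

  sum-++ : ∀ {B} (xs ys : List B) f → sum (xs ++ ys) f ≡ sum xs f ∙ sum ys f
  sum-++ []       ys f = sym (identityˡ _)
  sum-++ (x ∷ xs) ys f = trans (cong (f x ∙_) (sum-++ xs ys f)) (sym (assoc (f x) _ _))

  sum-map : ∀ {B C} (g : B → C) (xs : List B) f → sum (map g xs) f ≡ sum xs (f ∘ g)
  sum-map g xs f = cong (foldr _∙_ ε) (sym (map-∘ xs))

  sum-cong : ∀ {B} (xs : List B) {f g} → (∀ x → f x ≡ g x) → sum xs f ≡ sum xs g
  sum-cong xs f≗g = cong (foldr _∙_ ε) (map-cong f≗g xs)

  sum-ε : ∀ {B} (xs : List B) {f} → (∀ x → f x ≡ ε) → sum xs f ≡ ε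
  sum-ε []       f≗ε = refl
  sum-ε (x ∷ xs) f≗ε = trans (cong₂ _∙_ (f≗ε x) (sum-ε xs f≗ε)) (identityʳ ε)

  sum-filterᵇ : ∀ {B} (p : B → Bool) (xs : List B) f →
    sum (filterᵇ p xs) f ≡ sum xs (λ x → if p x then f x else ε)
  sum-filterᵇ p []       f = refl
  sum-filterᵇ p (x ∷ xs) f with p x
  ... | true  = cong (f x ∙_) (sum-filterᵇ p xs f)
  ... | false = trans (sum-filterᵇ p xs f) (sym (identityˡ _))

  sum-allSubsets : ∀ n (f : Subset (suc n) → A) → sum (allSubsets (suc n)) f ≡
    sum (allSubsets n) (f ∘ (outside ∷_)) ∙ sum (allSubsets n) (f ∘ (inside ∷_))
  sum-allSubsets n f = trans (sum-++ (map _ (allSubsets n)) _ f)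
    (cong₂ _∙_ (sum-map _ (allSubsets n) f) (sum-map _ (allSubsets n) f))

  sum-cdWords : ∀ n (f : List CD → A) → sum (cdWords (suc (suc n))) f ≡
    sum (cdWords (suc n)) (f ∘ (c ∷_)) ∙ sum (cdWords n) (f ∘ (d ∷_))
  sum-cdWords n f = trans (sum-++ (map _ (cdWords (suc n))) _ f)
    (cong₂ _∙_ (sum-map _ (cdWords (suc n)) f) (sum-map _ (cdWords n) f))

  sum-⊆⊥ : ∀ n (g : Subset n → A) →
    sum (allSubsets n) (λ T → if does (T ⊆? ⊥) then g T else ε) ≡ g ⊥
  sum-⊆⊥ zero    g = identityʳ (g [])
  sum-⊆⊥ (suc n) g = trans (sum-allSubsets n _)
    (trans (cong₂ _∙_ (sum-⊆⊥ n (g ∘ (outside ∷_))) (sum-ε (allSubsets n) λ _ → refl)) (identityʳ _))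

  sum-⊆singleton : ∀ k j (g : Subset (suc (k + j)) → A) →
    sum (allSubsets (suc (k + j))) (λ T → if does (T ⊆? singleton k j) then g T else ε) ≡
    g ⊥ ∙ g (singleton k j)
  sum-⊆singleton zero    j g = trans (sum-allSubsets j _)
    (cong₂ _∙_ (sum-⊆⊥ j (g ∘ (outside ∷_))) (sum-⊆⊥ j (g ∘ (inside ∷_))))
  sum-⊆singleton (suc k) j g = trans (sum-allSubsets (suc (k + j)) _)
    (trans (cong₂ _∙_ (sum-⊆singleton k j (g ∘ (outside ∷_))) (sum-ε (allSubsets (suc (k + j))) λ _ → refl))
      (identityʳ _))

module ℕΣ = MonoidSum ℕP.+-0-isMonoid
module ℤΣ = MonoidSum ℤP.+-0-isMonoid

-- Flag vectors of the Boolean lattice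

filterᵇ-map : ∀ {A B : Set} {p : B → Bool} {q : A → Bool} (f : A → B) →
  (∀ x → p (f x) ≡ q x) → ∀ xs → filterᵇ p (map f xs) ≡ map f (filterᵇ q xs)
filterᵇ-map f p∘f≗q [] = refl
filterᵇ-map {q = q} f p∘f≗q (x ∷ xs) rewrite p∘f≗q x with q x
... | true  = cong (f x ∷_) (filterᵇ-map f p∘f≗q xs)
... | false = filterᵇ-map f p∘f≗q xs

rankList-tail : ∀ {n} s (S : Subset n) →
  map (λ i → suc (toℕ i)) (filterᵇ (λ i → ⌊ i ∈? (s ∷ S) ⌋) (tabulate fsuc)) ≡ map suc (rankList S)
rankList-tail {n} s S = begin
  map (suc ∘ toℕ) (filterᵇ p (tabulate fsuc))        ≡⟨ cong (map (suc ∘ toℕ) ∘ filterᵇ p) (map-tabulate id fsuc) ⟨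
  map (suc ∘ toℕ) (filterᵇ p (map fsuc (allFin n)))  ≡⟨ cong (map (suc ∘ toℕ)) (filterᵇ-map fsuc p∘fsuc≗ (allFin n)) ⟩
  map (suc ∘ toℕ) (map fsuc elems)                   ≡⟨ map-∘ elems ⟨
  map (suc ∘ suc ∘ toℕ) elems                        ≡⟨ map-∘ elems ⟩
  map suc (rankList S)                               ∎
  where
  open ≡-Reasoning
  p = λ i → ⌊ i ∈? (s ∷ S) ⌋
  p∘fsuc≗ : ∀ i → p (fsuc i) ≡ ⌊ i ∈? S ⌋
  p∘fsuc≗ i = ⌊⌋-map′ _ _ (i ∈? S)
  elems = filterᵇ (λ i → ⌊ i ∈? S ⌋) (allFin n)

rankList-⊥ : ∀ n → rankList (⊥ {n}) ≡ []
rankList-⊥ zero    = refl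
rankList-⊥ (suc n) = trans (rankList-tail outside ⊥) (cong (map suc) (rankList-⊥ n))

rankList-singleton : ∀ k j → rankList (singleton k j) ≡ suc k ∷ []
rankList-singleton zero    j = cong (1 ∷_) (trans (rankList-tail inside ⊥) (cong (map suc) (rankList-⊥ j)))
rankList-singleton (suc k) j = trans (rankList-tail outside (singleton k j)) (cong (map suc) (rankList-singleton k j))

⊥⊂?-nonempty : ∀ {n} (y : Subset n) → 0 < ∣ y ∣ → does (⊥ ⊂? y) ≡ true
⊥⊂?-nonempty (outside ∷ y) 0<∣y∣ = ⊥⊂?-nonempty y 0<∣y∣
⊥⊂?-nonempty (inside  ∷ y) _     = dec-true (⊥ ⊆? y) ⊥⊆

⊂?⊤-nonfull : ∀ {n} (y : Subset n) → ∣ y ∣ < n → does (y ⊂? ⊤) ≡ true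
⊂?⊤-nonfull (outside ∷ y) _             = dec-true (y ⊆? ⊤) ⊆⊤
⊂?⊤-nonfull (inside  ∷ y) (s≤s ∣y∣<n) = ⊂?⊤-nonfull y ∣y∣<n

countChains-nonfull : ∀ {N} (y : Subset N) → ∣ y ∣ < N → countChains N y [] ≡ 1
countChains-nonfull y ∣y∣<N with y ⊂? ⊤ | ⊂?⊤-nonfull y ∣y∣<N
... | yes _ | _  = refl
... | no  _ | ()

-- Stated with `does` rather than ⌊_⌋ so that the summand reduces on inside ∷ y and outside ∷ y.
subsets-of-size : ∀ n s → ℕΣ.sum (allSubsets n) (λ y → if does (∣ y ∣ ℕ.≟ s) then 1 else 0) ≡ n C s
subsets-of-size zero    zero    = refl
subsets-of-size zero    (suc s) = refl
subsets-of-size (suc n) zero    = trans (ℕΣ.sum-allSubsets n _)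
  (cong₂ _+_ (subsets-of-size n zero) (ℕΣ.sum-ε (allSubsets n) λ _ → refl))
subsets-of-size (suc n) (suc s) = trans (ℕΣ.sum-allSubsets n _)
  (trans (cong₂ _+_ (subsets-of-size n (suc s)) (subsets-of-size n s))
    (trans (ℕP.+-comm (n C suc s) (n C s)) (nCk+nC[k+1]≡[n+1]C[k+1] n s)))

countChains-rank : ∀ N s → suc s < N → countChains N ⊥ (suc s ∷ []) ≡ N C suc s
countChains-rank N s s+1<N = trans (ℕΣ.sum-filterᵇ _ (allSubsets N) _)
  (trans (ℕΣ.sum-cong (allSubsets N) λ y →
            trans (rank-indicator y) (cong (if_then 1 else 0) (isYes≗does (∣ y ∣ ℕ.≟ suc s))))
    (subsets-of-size N (suc s)))
  where
  rank-indicator : ∀ y → (if ⌊ ∣ y ∣ ℕ.≟ suc s ⌋ ∧ ⌊ ⊥ ⊂? y ⌋ then countChains N y [] else 0)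
                         ≡ (if ⌊ ∣ y ∣ ℕ.≟ suc s ⌋ then 1 else 0)
  rank-indicator y with ∣ y ∣ ℕ.≟ suc s
  ... | no  _      = refl
  ... | yes ∣y∣≡s+1 = begin
    (if ⌊ ⊥ ⊂? y ⌋ then countChains N y [] else 0) ≡⟨ cong (if_then countChains N y [] else 0) ⊥⊂y ⟩
    countChains N y []                             ≡⟨ countChains-nonfull y (subst (_< N) (sym ∣y∣≡s+1) s+1<N) ⟩
    1                                              ∎
    where
    open ≡-Reasoning
    ⊥⊂y : ⌊ ⊥ ⊂? y ⌋ ≡ true
    ⊥⊂y = trans (isYes≗does (⊥ ⊂? y)) (⊥⊂?-nonempty y (subst (0 <_) (sym ∣y∣≡s+1) z<s))

fB-⊥ : ∀ r → fB r ⊥ ≡ 1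
fB-⊥ r = trans (cong (countChains (suc r) ⊥) (rankList-⊥ r))
  (countChains-nonfull ⊥ (subst (_< suc r) (sym (∣⊥∣≡0 r)) z<s))

fB-singleton : ∀ k j → fB (suc (k + j)) (singleton k j) ≡ suc (suc (k + j)) C suc k
fB-singleton k j = trans (cong (countChains (suc (suc (k + j))) ⊥) (rankList-singleton k j))
  (countChains-rank _ k (s≤s (s≤s (ℕP.m≤m+n k j))))

hB-as-sum : ∀ r S → hB r S ≡
  ℤΣ.sum (allSubsets r) (λ T → if does (T ⊆? S) then signPow (∣ S ∣ ∸ ∣ T ∣) ℤ.* ℤ.+ fB r T else 0ℤ)
hB-as-sum r S = trans (ℤΣ.sum-filterᵇ _ (allSubsets r) _)
  (ℤΣ.sum-cong (allSubsets r) λ T →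
    cong (if_then signPow (∣ S ∣ ∸ ∣ T ∣) ℤ.* ℤ.+ fB r T else 0ℤ) (isYes≗does (T ⊆? S)))

hB-⊥ : ∀ r → hB r ⊥ ≡ 1ℤ
hB-⊥ r = trans (hB-as-sum r ⊥) (trans (ℤΣ.sum-⊆⊥ r _)
  (cong₂ (λ e f → signPow e ℤ.* ℤ.+ f) (ℕP.n∸n≡0 ∣ ⊥ {r} ∣) (fB-⊥ r)))

∣singleton∣≡1 : ∀ k j → ∣ singleton k j ∣ ≡ 1
∣singleton∣≡1 zero    j = cong suc (∣⊥∣≡0 j)
∣singleton∣≡1 (suc k) j = ∣singleton∣≡1 k j

hB-singleton : ∀ k j → hB (suc (k + j)) (singleton k j) ≡ ℤ.+ (suc (suc (k + j)) C suc k) ℤ.- 1ℤ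
hB-singleton k j = begin
  hB r S                        ≡⟨ hB-as-sum r S ⟩
  ℤΣ.sum (allSubsets r) _       ≡⟨ ℤΣ.sum-⊆singleton k j _ ⟩
  term ⊥ ℤ.+ term S             ≡⟨ cong₂ ℤ._+_ term-⊥ term-S ⟩
  -1ℤ ℤ.+ ℤ.+ (suc r C suc k)   ≡⟨ ℤP.+-comm -1ℤ (ℤ.+ (suc r C suc k)) ⟩
  ℤ.+ (suc r C suc k) ℤ.- 1ℤ    ∎
  where
  open ≡-Reasoning
  r = suc (k + j)
  S = singleton k j
  term : Subset r → ℤ
  term T = signPow (∣ S ∣ ∸ ∣ T ∣) ℤ.* ℤ.+ fB r T
  term-⊥ : term ⊥ ≡ -1ℤ
  term-⊥ = cong₂ (λ e f → signPow e ℤ.* ℤ.+ f) (cong₂ _∸_ (∣singleton∣≡1 k j) (∣⊥∣≡0 r)) (fB-⊥ r)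
  term-S : term S ≡ ℤ.+ (suc r C suc k)
  term-S = trans (cong₂ (λ e f → signPow e ℤ.* ℤ.+ f) (ℕP.n∸n≡0 ∣ S ∣) (fB-singleton k j)) (ℤP.*-identityˡ _)

-- The cd-index of the Boolean lattice

-- IsCDIndexOfBoolean r ψ unfolds to ∀ S → hB r S ≡ expansion r ψ (toList S).
expansion : ℕ → (List CD → ℤ) → List Bool → ℤ
expansion r ψ w = ℤΣ.sum (cdWords r) (λ u → ψ u ℤ.* ℤ.+ abCoeff u w)

expansion-⊥ : ∀ n ψ → expansion n ψ (toList (⊥ {n})) ≡ ψ (replicate n c)
expansion-⊥ zero          ψ = trans (ℤP.+-identityʳ _) (ℤP.*-identityʳ _)
expansion-⊥ (suc zero)    ψ = trans (ℤP.+-identityʳ _) (ℤP.*-identityʳ _)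
expansion-⊥ (suc (suc n)) ψ = trans (ℤΣ.sum-cdWords n _)
  (trans (cong₂ ℤ._+_ (expansion-⊥ (suc n) (ψ ∘ (c ∷_))) (ℤΣ.sum-ε (cdWords n) λ u → ℤP.*-zeroʳ (ψ (d ∷ u))))
    (ℤP.+-identityʳ _))

expansion-singleton-zero : ∀ j ψ → expansion (suc (suc j)) ψ (toList (singleton zero (suc j))) ≡
  ψ (replicate (suc (suc j)) c) ℤ.+ ψ (cmdcn zero j)
expansion-singleton-zero j ψ = trans (ℤΣ.sum-cdWords j _)
  (cong₂ ℤ._+_ (expansion-⊥ (suc j) (ψ ∘ (c ∷_))) (expansion-⊥ j (ψ ∘ (d ∷_))))

expansion-singleton-suc : ∀ k j ψ → expansion (suc (suc k + suc j)) ψ (toList (singleton (suc k) (suc j))) ≡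
  ψ (replicate (suc (suc k + suc j)) c) ℤ.+ (ψ (cmdcn (suc k) j) ℤ.+ ψ (cmdcn k (suc j)))
expansion-singleton-suc zero    j ψ = trans (ℤΣ.sum-cdWords (suc j) _)
  (trans (cong₂ ℤ._+_ (expansion-singleton-zero j (ψ ∘ (c ∷_))) (expansion-⊥ (suc j) (ψ ∘ (d ∷_))))
    (ℤP.+-assoc (ψ (replicate (suc (suc (suc j))) c)) (ψ (cmdcn 1 j)) (ψ (cmdcn 0 (suc j)))))
expansion-singleton-suc (suc k) j ψ = trans (ℤΣ.sum-cdWords (suc (k + suc j)) _)
  (trans (cong₂ ℤ._+_ (expansion-singleton-suc k j (ψ ∘ (c ∷_)))
                      (ℤΣ.sum-ε (cdWords (suc (k + suc j))) λ u → ℤP.*-zeroʳ (ψ (d ∷ u))))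
    (ℤP.+-identityʳ _))

cdIndex-cⁿ : ∀ {r ψ} → IsCDIndexOfBoolean r ψ → ψ (replicate r c) ≡ 1ℤ
cdIndex-cⁿ {r} {ψ} isCD = trans (sym (expansion-⊥ r ψ)) (trans (sym (isCD ⊥)) (hB-⊥ r))

pascal-peel : ∀ p q {x} y → x ≡ ℤ.+ p ℤ.- 1ℤ → 1ℤ ℤ.+ (y ℤ.+ x) ≡ ℤ.+ (p + q) ℤ.- 1ℤ → y ≡ ℤ.+ q ℤ.- 1ℤ
pascal-peel p q y refl sum≡ = begin
  y                                            ≡⟨ isolate y (ℤ.+ p) ⟩
  1ℤ ℤ.+ (y ℤ.+ (ℤ.+ p ℤ.- 1ℤ)) ℤ.- ℤ.+ p     ≡⟨ cong (ℤ._- ℤ.+ p) sum≡ ⟩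
  ℤ.+ p ℤ.+ ℤ.+ q ℤ.- 1ℤ ℤ.- ℤ.+ p             ≡⟨ cancel (ℤ.+ p) (ℤ.+ q) ⟩
  ℤ.+ q ℤ.- 1ℤ                                 ∎
  where
  open ≡-Reasoning
  isolate : ∀ y P → y ≡ 1ℤ ℤ.+ (y ℤ.+ (P ℤ.- 1ℤ)) ℤ.- P
  isolate = ℤ-solve-∀
  cancel : ∀ P Q → P ℤ.+ Q ℤ.- 1ℤ ℤ.- P ≡ Q ℤ.- 1ℤ
  cancel = ℤ-solve-∀

cdIndex-cᵐdcⁿ : ∀ m n ψ → IsCDIndexOfBoolean (suc (suc (m + n))) ψ →
  ψ (cmdcn m n) ≡ ℤ.+ ((suc m + suc n) C suc m) ℤ.- 1ℤ
cdIndex-cᵐdcⁿ zero n ψ isCD = pascal-peel 1 (suc (suc n) C 1) (ψ (cmdcn 0 n)) refl (begin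
  1ℤ ℤ.+ (ψ (cmdcn 0 n) ℤ.+ 0ℤ)                            ≡⟨ cong (λ z → 1ℤ ℤ.+ z) (ℤP.+-identityʳ (ψ (cmdcn 0 n))) ⟩
  1ℤ ℤ.+ ψ (cmdcn 0 n)                                      ≡⟨ cong (ℤ._+ ψ (cmdcn 0 n)) (cdIndex-cⁿ {ψ = ψ} isCD) ⟨
  ψ (replicate (suc (suc n)) c) ℤ.+ ψ (cmdcn 0 n)           ≡⟨ expansion-singleton-zero n ψ ⟨
  expansion (suc (suc n)) ψ (toList (singleton 0 (suc n)))  ≡⟨ isCD (singleton 0 (suc n)) ⟨
  hB (suc (suc n)) (singleton 0 (suc n))                    ≡⟨ hB-singleton 0 (suc n) ⟩
  ℤ.+ (suc (suc (suc n)) C 1) ℤ.- 1ℤ                        ≡⟨ cong (λ M → ℤ.+ M ℤ.- 1ℤ) pascal ⟨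
  ℤ.+ (1 + suc (suc n) C 1) ℤ.- 1ℤ                          ∎)
  where
  open ≡-Reasoning
  pascal = nCk+nC[k+1]≡[n+1]C[k+1] (suc (suc n)) 0
cdIndex-cᵐdcⁿ (suc m) n ψ isCD =
  pascal-peel (suc N C suc m) (suc N C suc (suc m)) (ψ (cmdcn (suc m) n)) previous (begin
    1ℤ ℤ.+ neighbours                                        ≡⟨ cong (ℤ._+ neighbours) (cdIndex-cⁿ {ψ = ψ} isCD′) ⟨
    ψ (replicate (suc N) c) ℤ.+ neighbours                   ≡⟨ expansion-singleton-suc m n ψ ⟨
    expansion (suc N) ψ (toList (singleton (suc m) (suc n))) ≡⟨ isCD′ (singleton (suc m) (suc n)) ⟨
    hB (suc N) (singleton (suc m) (suc n))                   ≡⟨ hB-singleton (suc m) (suc n) ⟩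
    ℤ.+ (suc (suc N) C suc (suc m)) ℤ.- 1ℤ                   ≡⟨ cong (λ M → ℤ.+ M ℤ.- 1ℤ) pascal ⟨
    ℤ.+ (suc N C suc m + suc N C suc (suc m)) ℤ.- 1ℤ        ∎)
  where
  open ≡-Reasoning
  N = suc m + suc n
  neighbours = ψ (cmdcn (suc m) n) ℤ.+ ψ (cmdcn m (suc n))
  pascal = nCk+nC[k+1]≡[n+1]C[k+1] (suc N) (suc m)
  isCD′ : IsCDIndexOfBoolean (suc (suc (m + suc n))) ψ
  isCD′ = subst (λ r → IsCDIndexOfBoolean (suc (suc r)) ψ) (sym (ℕP.+-suc m n)) isCD
  previous : ψ (cmdcn m (suc n)) ≡ ℤ.+ (suc N C suc m) ℤ.- 1ℤ
  previous = trans (cdIndex-cᵐdcⁿ m (suc n) ψ isCD′)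
    (cong (λ M → ℤ.+ (M C suc m) ℤ.- 1ℤ) (ℕP.+-suc (suc m) (suc n)))

lemma7p1 : (m₁ n₁ m₂ n₂ : ℕ) → m₁ + n₁ ≡ m₂ + n₂ → ∣ m₁ - n₁ ∣ ≤ ∣ m₂ - n₂ ∣ →
    (β : List CD → ℤ) → IsCDIndexOfBoolean (m₁ + n₁ + 2) β →
    (β (cmdcn m₂ n₂) ℤ.≤ β (cmdcn m₁ n₁)) ×
    (β (cmdcn m₁ n₁) ≡ β (cmdcn m₂ n₂) ⇔ ∣ m₁ - n₁ ∣ ≡ ∣ m₂ - n₂ ∣)
lemma7p1 m₁ n₁ m₂ n₂ sum≡ gap≤ β isCD = ≤-claim , mk⇔ to from
  where
  isCD₁ : IsCDIndexOfBoolean (suc (suc (m₁ + n₁))) β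
  isCD₁ = subst (λ r → IsCDIndexOfBoolean r β) (ℕP.+-comm (m₁ + n₁) 2) isCD
  value₁ = cdIndex-cᵐdcⁿ m₁ n₁ β isCD₁
  value₂ = cdIndex-cᵐdcⁿ m₂ n₂ β (subst (λ r → IsCDIndexOfBoolean (suc (suc r)) β) sum≡ isCD₁)
  shifted-sum≡ : suc m₁ + suc n₁ ≡ suc m₂ + suc n₂
  shifted-sum≡ = cong suc (trans (ℕP.+-suc m₁ n₁) (trans (cong suc sum≡) (sym (ℕP.+-suc m₂ n₂))))
  strict : ∣ m₁ - n₁ ∣ < ∣ m₂ - n₂ ∣ → β (cmdcn m₂ n₂) ℤ.< β (cmdcn m₁ n₁)
  strict gap< = subst₂ ℤ._<_ (sym value₂) (sym value₁) (ℤP.+-monoˡ-< -1ℤ (+<+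
    (more-balanced⇒larger-binomial {suc m₁} {suc n₁} {suc m₂} {suc n₂} shifted-sum≡ gap<)))
  from : ∣ m₁ - n₁ ∣ ≡ ∣ m₂ - n₂ ∣ → β (cmdcn m₁ n₁) ≡ β (cmdcn m₂ n₂)
  from gap≡ = trans value₁ (trans (cong (λ N → ℤ.+ N ℤ.- 1ℤ)
    (equally-balanced⇒equal-binomial {suc m₁} {suc n₁} {suc m₂} {suc n₂} shifted-sum≡ gap≡)) (sym value₂))
  to : β (cmdcn m₁ n₁) ≡ β (cmdcn m₂ n₂) → ∣ m₁ - n₁ ∣ ≡ ∣ m₂ - n₂ ∣
  to β≡ with ℕP.m≤n⇒m<n∨m≡n gap≤
  ... | inj₁ gap< = contradiction (sym β≡) (ℤP.<⇒≢ (strict gap<))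
  ... | inj₂ gap≡ = gap≡
  ≤-claim : β (cmdcn m₂ n₂) ℤ.≤ β (cmdcn m₁ n₁)
  ≤-claim with ℕP.m≤n⇒m<n∨m≡n gap≤
  ... | inj₁ gap< = ℤP.<⇒≤ (strict gap<)
  ... | inj₂ gap≡ = ℤP.≤-reflexive (sym (from gap≡))
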